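{- There is a deterministic adaptive algorithm that, for every undirected graph on $[n]$ with non-negative edge weights, makes $5n$ cut queries and outputs a set $T \subseteq [n]$ with $F(T) \ge \frac{1}{2}\max_{S \subseteq [n]} F(S)$.
   Context: Cut query model: an undirected graph on $[n]$ has non-negative edge weights $w_{i,j}$ and cut function $F(S) = \sum_{i \in S, j \notin S} w_{i,j}$; an algorithm accesses the graph only by submitting sets $S$ (possibly chosen adaptively) and receiving $F(S)$.
   Formalization: The edge weights $w_{i,j}$ are non-negative rationals, so the cut values $F(S)$ the algorithm receives are rational as well. -}

module Defs where

open import Data.Nat using (ℕ; zero; suc)
open import Data.Bool using (Bool; true; false; _∧_; not; if_then_else_)
open import Data.Fin using (Fin; zero; suc)
open import Data.Fin.Subset using (Subset)
open import Data.Vec using (lookup)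
open import Data.Rational using (ℚ; 0ℚ; _+_; _≤_)
open import Relation.Binary.PropositionalEquality using (_≡_)

sumFin : (n : ℕ) → (Fin n → ℚ) → ℚ
sumFin zero    f = 0ℚ
sumFin (suc n) f = f zero + sumFin n (λ i → f (suc i))

Weights : ℕ → Set
Weights n = Fin n → Fin n → ℚ

Symmetric : {n : ℕ} → Weights n → Set
Symmetric w = ∀ i j → w i j ≡ w j i

NonNeg : {n : ℕ} → Weights n → Set
NonNeg w = ∀ i j → 0ℚ ≤ w i j

cut : {n : ℕ} → Weights n → Subset n → ℚ
cut {n} w S = sumFin n λ i → sumFin n λ j →
  if lookup S i ∧ not (lookup S j) then w i j else 0ℚ

-- Deterministic adaptive cut-query algorithm (decision tree) on [n]
-- making at most k queries: either output a set, or query a set S and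
-- continue depending on the answer F(S).
data CutAlg (n : ℕ) : ℕ → Set where
  output : {k : ℕ} → Subset n → CutAlg n k
  query  : {k : ℕ} → Subset n → (ℚ → CutAlg n k) → CutAlg n (suc k)

run : {n k : ℕ} → CutAlg n k → Weights n → Subset n
run (output T)  w = T
run (query S c) w = run (c (cut w S)) w

{-# OPTIONS --safe #-}
-- Greedy: decide the tail vertices first, keeping the head outside, then put the head on the
-- side that cuts the larger share of its edges into the tail.  That share is at least half the
-- head's degree into the tail, which bounds the head's contribution to any cut S, so induction
-- on the number of vertices gives the factor ½.
-- While the tail is being decided the oracle answers f X = F (processed-vertices-outside ++ X),
-- the cut of the induced graph plus a modular term (edges to the processed vertices) plus a
-- constant.  The head's marginal f (1 ∷ X) − f (0 ∷ X) is therefore its gain difference at X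
-- plus an unknown constant, and comparing the marginals at T and ∁ T (four queries) eliminates
-- that constant.
module Submission where

open import Defs
open import Data.Nat using (ℕ; _*_)
open import Data.Fin.Subset using (Subset)
open import Data.Product using (Σ)
open import Data.Rational using (½; _≤_) renaming (_*_ to _*ℚ_)

open import Algebra.Bundles using (CommutativeMonoid)
import Algebra.Properties.CommutativeSemigroup as CommSemigroupProperties
open import Data.Bool using (Bool; true; false; not; _∧_; if_then_else_)
open import Data.Bool.Properties using (not-involutive)
open import Data.Fin using (Fin; zero; suc)
open import Data.Fin.Subset using (∁)
open import Data.Nat as ℕ using (zero; suc)
import Data.Nat.Properties as ℕ
open import Data.Product using (_,_)
open import Data.Rational using (ℚ; 0ℚ; _+_; _-_)
open import Data.Rational.Properties
  using (≤-refl; ≤-reflexive; <⇒≤; ≰⇒>; _≤?_; +-mono-≤; +-monoʳ-≤; +-comm; +-identityˡ; +-identityʳ;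
         *-zeroʳ; *-distribˡ-+; *-monoˡ-≤-nonNeg; +-0-commutativeMonoid; module ≤-Reasoning)
open import Data.Rational.Solver using (module +-*-Solver)
open import Data.Vec using ([]; _∷_; lookup)
open import Data.Vec.Properties using (lookup-map)
open import Function using (id)
open import Relation.Nullary using (Dec; does; yes; no)
open import Relation.Binary.PropositionalEquality
  using (_≡_; refl; sym; trans; cong; cong₂; subst; module ≡-Reasoning)

open CommSemigroupProperties (CommutativeMonoid.commutativeSemigroup +-0-commutativeMonoid)
  using (interchange)
open CommSemigroupProperties ℕ.+-commutativeSemigroup using (x∙yz≈y∙xz)
open +-*-Solver using (solve; _:=_; _:+_; _:-_; _:*_; con)

sumFin-cong : ∀ n {f g : Fin n → ℚ} → (∀ i → f i ≡ g i) → sumFin n f ≡ sumFin n g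
sumFin-cong zero    f≗g = refl
sumFin-cong (suc n) f≗g = cong₂ _+_ (f≗g zero) (sumFin-cong n (λ i → f≗g (suc i)))

sumFin-distrib-+ : ∀ n (f g : Fin n → ℚ) →
  sumFin n (λ i → f i + g i) ≡ sumFin n f + sumFin n g
sumFin-distrib-+ zero    f g = sym (+-identityˡ 0ℚ)
sumFin-distrib-+ (suc n) f g =
  trans (cong (f zero + g zero +_) (sumFin-distrib-+ n (λ i → f (suc i)) (λ i → g (suc i))))
        (interchange (f zero) (g zero) _ _)

sumFin-zero : ∀ n → sumFin n (λ _ → 0ℚ) ≡ 0ℚ
sumFin-zero zero    = refl
sumFin-zero (suc n) = trans (+-identityˡ _) (sumFin-zero n)

sumFin-mono-≤ : ∀ n {f g : Fin n → ℚ} → (∀ i → f i ≤ g i) → sumFin n f ≤ sumFin n g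
sumFin-mono-≤ zero    f≤g = ≤-refl
sumFin-mono-≤ (suc n) f≤g = +-mono-≤ (f≤g zero) (sumFin-mono-≤ n (λ i → f≤g (suc i)))

sumIn : ∀ {n} → (Fin n → ℚ) → Subset n → ℚ
sumIn {n} c X = sumFin n λ j → if lookup X j then c j else 0ℚ

sumIn-cong : ∀ {n} {c d : Fin n → ℚ} → (∀ j → c j ≡ d j) → ∀ X → sumIn c X ≡ sumIn d X
sumIn-cong {n} c≗d X = sumFin-cong n λ j → cong (if lookup X j then_else 0ℚ) (c≗d j)

sumIn-distrib-+ : ∀ {n} (c d : Fin n → ℚ) X →
  sumIn (λ j → c j + d j) X ≡ sumIn c X + sumIn d X
sumIn-distrib-+ {n} c d X =
  trans (sumFin-cong n pointwise) (sumFin-distrib-+ n _ _)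
  where
  pointwise : ∀ j → (if lookup X j then c j + d j else 0ℚ)
                  ≡ (if lookup X j then c j else 0ℚ) + (if lookup X j then d j else 0ℚ)
  pointwise j with lookup X j
  ... | true  = refl
  ... | false = sym (+-identityˡ 0ℚ)

sumIn-zero : ∀ {n} (X : Subset n) → sumIn (λ _ → 0ℚ) X ≡ 0ℚ
sumIn-zero {n} X = trans (sumFin-cong n pointwise) (sumFin-zero n)
  where
  pointwise : ∀ j → (if lookup X j then 0ℚ else 0ℚ) ≡ 0ℚ
  pointwise j with lookup X j
  ... | true  = refl
  ... | false = refl

sumIn+sumIn-∁ : ∀ {n} (c : Fin n → ℚ) X → sumIn c X + sumIn c (∁ X) ≡ sumFin n c
sumIn+sumIn-∁ {n} c X = trans (sym (sumFin-distrib-+ n _ _)) (sumFin-cong n pointwise)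
  where
  pointwise : ∀ j → (if lookup X j then c j else 0ℚ) + (if lookup (∁ X) j then c j else 0ℚ) ≡ c j
  pointwise j rewrite lookup-map j not X with lookup X j
  ... | true  = +-identityʳ (c j)
  ... | false = +-identityˡ (c j)

sumIn≤sumFin : ∀ {n} (c : Fin n → ℚ) → (∀ j → 0ℚ ≤ c j) → ∀ X → sumIn c X ≤ sumFin n c
sumIn≤sumFin {n} c c≥0 X = sumFin-mono-≤ n pointwise
  where
  pointwise : ∀ j → (if lookup X j then c j else 0ℚ) ≤ c j
  pointwise j with lookup X j
  ... | true  = ≤-refl
  ... | false = c≥0 j

∁-involutive : ∀ {n} (X : Subset n) → ∁ (∁ X) ≡ X
∁-involutive []      = refl
∁-involutive (x ∷ X) = cong₂ _∷_ (not-involutive x) (∁-involutive X)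

cut≡sumIn-sumIn-∁ : ∀ {n} (w : Weights n) X → cut w X ≡ sumIn (λ i → sumIn (w i) (∁ X)) X
cut≡sumIn-sumIn-∁ {n} w X = sumFin-cong n row
  where
  row : ∀ i → sumFin n (λ j → if lookup X i ∧ not (lookup X j) then w i j else 0ℚ)
            ≡ (if lookup X i then sumIn (w i) (∁ X) else 0ℚ)
  row i with lookup X i
  ... | true  = sumFin-cong n λ j → cong (if_then w i j else 0ℚ) (sym (lookup-map j not X))
  ... | false = sumFin-zero n

tailWeights : ∀ {n} → Weights (suc n) → Weights n
tailWeights v i j = v (suc i) (suc j)

headRow : ∀ {n} → Weights (suc n) → Fin n → ℚ
headRow v j = v zero (suc j)

headDegree : ∀ {n} → Weights (suc n) → ℚ
headDegree {n} v = sumFin n (headRow v)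

headGain : ∀ {n} → Weights (suc n) → Bool → Subset n → ℚ
headGain v b X = if b then sumIn (headRow v) (∁ X) else sumIn (headRow v) X

cut-∷ : ∀ {n} (v : Weights (suc n)) → Symmetric v → ∀ b X →
  cut v (b ∷ X) ≡ cut (tailWeights v) X + headGain v b X
cut-∷ v sym-v b X = trans (cut≡sumIn-sumIn-∁ v (b ∷ X)) (split b)
  where
  open ≡-Reasoning
  r : Fin _ → ℚ
  r = headRow v
  tailCut : ℚ
  tailCut = sumIn (λ i → sumIn (tailWeights v i) (∁ X)) X
  tailCut≡ : tailCut ≡ cut (tailWeights v) X
  tailCut≡ = sym (cut≡sumIn-sumIn-∁ (tailWeights v) X)
  split : ∀ b → sumIn (λ i → sumIn (v i) (∁ (b ∷ X))) (b ∷ X)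
              ≡ cut (tailWeights v) X + headGain v b X
  split true = begin
    (0ℚ + sumIn r (∁ X)) + sumIn (λ i → 0ℚ + sumIn (tailWeights v i) (∁ X)) X
      ≡⟨ cong₂ _+_ (+-identityˡ (sumIn r (∁ X)))
                   (sumIn-cong (λ i → +-identityˡ (sumIn (tailWeights v i) (∁ X))) X) ⟩
    sumIn r (∁ X) + tailCut
      ≡⟨ +-comm (sumIn r (∁ X)) tailCut ⟩
    tailCut + sumIn r (∁ X)
      ≡⟨ cong (_+ sumIn r (∁ X)) tailCut≡ ⟩
    cut (tailWeights v) X + sumIn r (∁ X) ∎
  split false = begin
    0ℚ + sumIn (λ i → v (suc i) zero + sumIn (tailWeights v i) (∁ X)) X
      ≡⟨ +-identityˡ (sumIn (λ i → v (suc i) zero + sumIn (tailWeights v i) (∁ X)) X) ⟩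
    sumIn (λ i → v (suc i) zero + sumIn (tailWeights v i) (∁ X)) X
      ≡⟨ sumIn-distrib-+ (λ i → v (suc i) zero) (λ i → sumIn (tailWeights v i) (∁ X)) X ⟩
    sumIn (λ i → v (suc i) zero) X + tailCut
      ≡⟨ cong₂ _+_ (sumIn-cong (λ i → sym-v (suc i) zero) X) tailCut≡ ⟩
    sumIn r X + cut (tailWeights v) X
      ≡⟨ +-comm (sumIn r X) (cut (tailWeights v) X) ⟩
    cut (tailWeights v) X + sumIn r X ∎

-- y = ½ (x + y) + ¼ (b − a) with a = (x − y) + z and b = (y − x) + z.
½[x+y]≤y : ∀ x y z → (x - y) + z ≤ (y - x) + z → ½ *ℚ (x + y) ≤ y
½[x+y]≤y x y z a≤b = begin
  ½ *ℚ (x + y)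
    ≡⟨ solve 3 (λ x y z → con ½ :* (x :+ y)
                  := (y :- con ½ :* (con ½ :* ((y :- x) :+ z))) :+ con ½ :* (con ½ :* ((x :- y) :+ z)))
             refl x y z ⟩
  (y - ¼b) + ½ *ℚ (½ *ℚ ((x - y) + z))
    ≤⟨ +-monoʳ-≤ (y - ¼b) (*-monoˡ-≤-nonNeg ½ (*-monoˡ-≤-nonNeg ½ a≤b)) ⟩
  (y - ¼b) + ¼b
    ≡⟨ solve 2 (λ y q → (y :- q) :+ q := y) refl y ¼b ⟩
  y ∎
  where
  open ≤-Reasoning
  ¼b : ℚ
  ¼b = ½ *ℚ (½ *ℚ ((y - x) + z))

½[x+y]≤chosen : ∀ x y z (a≤?b : Dec ((x - y) + z ≤ (y - x) + z)) →
  ½ *ℚ (x + y) ≤ (if does a≤?b then y else x)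
½[x+y]≤chosen x y z (yes a≤b) = ½[x+y]≤y x y z a≤b
½[x+y]≤chosen x y z (no  a≰b) = subst (λ t → ½ *ℚ t ≤ x) (+-comm y x) (½[x+y]≤y y x z (<⇒≤ (≰⇒> a≰b)))

record ShiftedCut {m} (f : Subset m → ℚ) (v : Weights m) : Set where
  field
    modular  : Fin m → ℚ
    offset   : ℚ
    f≡cut+modular+offset : ∀ X → f X ≡ cut v X + sumIn modular X + offset

open ShiftedCut

cut-shiftedCut : ∀ {n} (w : Weights n) → ShiftedCut (cut w) w
cut-shiftedCut w = record
  { modular = λ _ → 0ℚ
  ; offset  = 0ℚ
  ; f≡cut+modular+offset = λ X → sym (trans (+-identityʳ _)
      (trans (cong (cut w X +_) (sumIn-zero X)) (+-identityʳ (cut w X))))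
  }

headMarginal : ∀ {m} → (Subset (suc m) → ℚ) → Subset m → ℚ
headMarginal f X = f (true ∷ X) - f (false ∷ X)

shiftedCut-tail : ∀ {m} {f : Subset (suc m) → ℚ} {v : Weights (suc m)} → Symmetric v →
  ShiftedCut f v → ShiftedCut (λ X → f (false ∷ X)) (tailWeights v)
shiftedCut-tail {f = f} {v} sym-v sc = record
  { modular = λ j → headRow v j + modular sc (suc j)
  ; offset  = offset sc
  ; f≡cut+modular+offset = λ X → begin
      f (false ∷ X)
        ≡⟨ f≡cut+modular+offset sc (false ∷ X) ⟩
      cut v (false ∷ X) + (0ℚ + sumIn c′ X) + K
        ≡⟨ cong (λ t → t + (0ℚ + sumIn c′ X) + K) (cut-∷ v sym-v false X) ⟩
      (cut (tailWeights v) X + sumIn (headRow v) X) + (0ℚ + sumIn c′ X) + K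
        ≡⟨ solve 4 (λ a b d k → (a :+ b) :+ (con 0ℚ :+ d) :+ k := a :+ (b :+ d) :+ k)
                 refl (cut (tailWeights v) X) (sumIn (headRow v) X) (sumIn c′ X) K ⟩
      cut (tailWeights v) X + (sumIn (headRow v) X + sumIn c′ X) + K
        ≡⟨ cong (λ t → cut (tailWeights v) X + t + K) (sym (sumIn-distrib-+ (headRow v) c′ X)) ⟩
      cut (tailWeights v) X + sumIn (λ j → headRow v j + c′ j) X + K ∎
  }
  where
  open ≡-Reasoning
  c′ : Fin _ → ℚ
  c′ j = modular sc (suc j)
  K : ℚ
  K = offset sc

headMarginal-shiftedCut : ∀ {m} {f : Subset (suc m) → ℚ} {v : Weights (suc m)} → Symmetric v →
  (sc : ShiftedCut f v) → ∀ X →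
  headMarginal f X ≡ (sumIn (headRow v) (∁ X) - sumIn (headRow v) X) + modular sc zero
headMarginal-shiftedCut {f = f} {v} sym-v sc X = begin
  f (true ∷ X) - f (false ∷ X)
    ≡⟨ cong₂ _-_ (f≡cut+modular+offset sc (true ∷ X)) (f≡cut+modular+offset sc (false ∷ X)) ⟩
  (cut v (true ∷ X) + (z + sumIn c′ X) + K) - (cut v (false ∷ X) + (0ℚ + sumIn c′ X) + K)
    ≡⟨ cong₂ (λ p q → (p + (z + sumIn c′ X) + K) - (q + (0ℚ + sumIn c′ X) + K))
             (cut-∷ v sym-v true X) (cut-∷ v sym-v false X) ⟩
  ((t + o) + (z + l) + K) - ((t + s) + (0ℚ + l) + K)
    ≡⟨ solve 6 (λ t o s z l k → ((t :+ o) :+ (z :+ l) :+ k) :- ((t :+ s) :+ (con 0ℚ :+ l) :+ k)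
                  := (o :- s) :+ z) refl t o s z l K ⟩
  (o - s) + z ∎
  where
  open ≡-Reasoning
  c′ : Fin _ → ℚ
  c′ j = modular sc (suc j)
  z K t o s l : ℚ
  z = modular sc zero
  K = offset sc
  t = cut (tailWeights v) X
  o = sumIn (headRow v) (∁ X)
  s = sumIn (headRow v) X
  l = sumIn c′ X

headChoice : ∀ {m} → (Subset (suc m) → ℚ) → Subset m → Bool
headChoice f T = does (headMarginal f (∁ T) ≤? headMarginal f T)

headGain≤headDegree : ∀ {m} {v : Weights (suc m)} → NonNeg v → ∀ b X → headGain v b X ≤ headDegree v
headGain≤headDegree {v = v} v≥0 true  X = sumIn≤sumFin (headRow v) (λ j → v≥0 zero (suc j)) (∁ X)
headGain≤headDegree {v = v} v≥0 false X = sumIn≤sumFin (headRow v) (λ j → v≥0 zero (suc j)) X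

headChoice-gain : ∀ {m} {f : Subset (suc m) → ℚ} {v : Weights (suc m)} → Symmetric v →
  ShiftedCut f v → ∀ T → ½ *ℚ headDegree v ≤ headGain v (headChoice f T) T
headChoice-gain {f = f} {v} sym-v sc T = begin
  ½ *ℚ headDegree v
    ≡⟨ cong (½ *ℚ_) (sym (sumIn+sumIn-∁ (headRow v) T)) ⟩
  ½ *ℚ (s + o)
    ≤⟨ ½[x+y]≤chosen s o z ((s - o) + z ≤? (o - s) + z) ⟩
  headGain v (does ((s - o) + z ≤? (o - s) + z)) T
    ≡⟨ cong (λ b → headGain v b T) (sym choice≡) ⟩
  headGain v (headChoice f T) T ∎
  where
  open ≤-Reasoning
  s o z : ℚ
  s = sumIn (headRow v) T
  o = sumIn (headRow v) (∁ T)
  z = modular sc zero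
  choice≡ : headChoice f T ≡ does ((s - o) + z ≤? (o - s) + z)
  choice≡ = cong₂ (λ p q → does (p ≤? q))
    (trans (headMarginal-shiftedCut sym-v sc (∁ T))
           (cong (λ Y → (sumIn (headRow v) Y - o) + z) (∁-involutive T)))
    (headMarginal-shiftedCut sym-v sc T)

greedySet : ∀ m → (Subset m → ℚ) → Subset m
greedySet zero    f = []
greedySet (suc m) f = headChoice f T ∷ T
  where
  T : Subset m
  T = greedySet m (λ X → f (false ∷ X))

greedySet-½-approx : ∀ m {f : Subset m → ℚ} {v : Weights m} → Symmetric v → NonNeg v →
  ShiftedCut f v → ∀ S → ½ *ℚ cut v S ≤ cut v (greedySet m f)
greedySet-½-approx zero    sym-v v≥0 sc [] = ≤-reflexive (*-zeroʳ ½)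
greedySet-½-approx (suc m) {f} {v} sym-v v≥0 sc (s ∷ S) = begin
  ½ *ℚ cut v (s ∷ S)
    ≡⟨ cong (½ *ℚ_) (cut-∷ v sym-v s S) ⟩
  ½ *ℚ (cut v′ S + headGain v s S)
    ≡⟨ *-distribˡ-+ ½ (cut v′ S) (headGain v s S) ⟩
  ½ *ℚ cut v′ S + ½ *ℚ headGain v s S
    ≤⟨ +-mono-≤ tail-approx (*-monoˡ-≤-nonNeg ½ (headGain≤headDegree v≥0 s S)) ⟩
  cut v′ T + ½ *ℚ headDegree v
    ≤⟨ +-monoʳ-≤ (cut v′ T) (headChoice-gain sym-v sc T) ⟩
  cut v′ T + headGain v (headChoice f T) T
    ≡⟨ sym (cut-∷ v sym-v (headChoice f T) T) ⟩
  cut v (greedySet (suc m) f) ∎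
  where
  open ≤-Reasoning
  v′ : Weights m
  v′ = tailWeights v
  T : Subset m
  T = greedySet m (λ X → f (false ∷ X))
  tail-approx : ½ *ℚ cut v′ S ≤ cut v′ T
  tail-approx = greedySet-½-approx m (λ i j → sym-v (suc i) (suc j)) (λ i j → v≥0 (suc i) (suc j))
                  (shiftedCut-tail sym-v sc) S

greedyQueries : ℕ → ℕ → ℕ
greedyQueries zero    k = k
greedyQueries (suc m) k = greedyQueries m (4 ℕ.+ k)

greedy : ∀ m {N k} → (Subset m → Subset N) → (Subset m → CutAlg N k) → CutAlg N (greedyQueries m k)
greedy zero    emb κ = κ []
greedy (suc m) emb κ = greedy m (λ X → emb (false ∷ X)) λ T →
  query (emb (true ∷ T))    λ a  → query (emb (false ∷ T))   λ b  →
  query (emb (true ∷ ∁ T))  λ a′ → query (emb (false ∷ ∁ T)) λ b′ →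
  κ (does ((a′ - b′) ≤? (a - b)) ∷ T)

run-greedy : ∀ m {N k} (emb : Subset m → Subset N) (κ : Subset m → CutAlg N k) w →
  run (greedy m emb κ) w ≡ run (κ (greedySet m (λ X → cut w (emb X)))) w
run-greedy zero    emb κ w = refl
run-greedy (suc m) emb κ w = run-greedy m (λ X → emb (false ∷ X)) _ w

greedyQueries≡ : ∀ m k → greedyQueries m k ≡ m * 4 ℕ.+ k
greedyQueries≡ zero    k = refl
greedyQueries≡ (suc m) k = trans (greedyQueries≡ m (4 ℕ.+ k)) (x∙yz≈y∙xz (m * 4) 4 k)

greedyQueries≤5n : ∀ n → greedyQueries n 0 ℕ.≤ 5 * n
greedyQueries≤5n n = begin
  greedyQueries n 0 ≡⟨ greedyQueries≡ n 0 ⟩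
  n * 4 ℕ.+ 0       ≡⟨ ℕ.+-identityʳ (n * 4) ⟩
  n * 4             ≤⟨ ℕ.*-monoʳ-≤ n (ℕ.n≤1+n 4) ⟩
  n * 5             ≡⟨ ℕ.*-comm n 5 ⟩
  5 * n             ∎
  where open ℕ.≤-Reasoning

weaken : ∀ {n k k′} → k ℕ.≤ k′ → CutAlg n k → CutAlg n k′
weaken _            (output T)    = output T
weaken (ℕ.s≤s k≤k′) (query S next) = query S λ a → weaken k≤k′ (next a)

run-weaken : ∀ {n k k′} (k≤k′ : k ℕ.≤ k′) (A : CutAlg n k) w → run (weaken k≤k′ A) w ≡ run A w
run-weaken _            (output T)    w = refl
run-weaken (ℕ.s≤s k≤k′) (query S next) w = run-weaken k≤k′ (next (cut w S)) w

lemmaE5 : (n : ℕ) → Σ (CutAlg n (5 * n)) λ A →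
    (w : Weights n) → Symmetric w → NonNeg w →
      (S : Subset n) → ½ *ℚ cut w S ≤ cut w (run A w)
lemmaE5 n = A , λ w sym-w w≥0 S → begin
  ½ *ℚ cut w S
    ≤⟨ greedySet-½-approx n sym-w w≥0 (cut-shiftedCut w) S ⟩
  cut w (greedySet n (cut w))
    ≡⟨ cong (cut w) (sym (trans (run-weaken (greedyQueries≤5n n) (greedy n id output) w)
                                (run-greedy n id output w))) ⟩
  cut w (run A w) ∎
  where
  open ≤-Reasoning
  A : CutAlg n (5 * n)
  A = weaken (greedyQueries≤5n n) (greedy n id output)
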